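{- For every $k$, there exists an explicitly constructible coloring family $\mathcal F$ for cactus-grid graphs on the $k\times k$ table of size $2^{O(k)}$.
   Context: A cactus-grid graph (on the $k\times k$ table) is a graph with vertex set $[k]\times[k]$ determined by a mapping $\delta:[k]\to[k]$, whose edge set consists exactly of: all edges between the vertices $(1,\delta(1)),\dots,(k,\delta(k))$ (a clique with one vertex from each row), and, for each $1\le i\le k$, the edges between $(i,\delta(i))$ and $(i,j)$ for all $j\ne\delta(i)$. A coloring family for cactus-grid graphs is a set $\mathcal F$ of functions $f:[k]\times[k]\to[k+1]$ such that for every cactus-grid graph $G$ on the $k\times k$ table there exists $f\in\mathcal F$ that is a proper coloring of $G$. -}

module Defs where

open import Data.Nat using (ℕ; suc)
open import Data.Fin using (Fin)
open import Data.Product using (_×_; _,_)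
open import Data.Sum using (_⊎_)
open import Data.List using (List)
open import Data.List.Relation.Unary.Any using (Any)
open import Relation.Binary.PropositionalEquality using (_≡_; _≢_)

-- Cells of the k × k table: (row i , column j), rows and columns indexed by Fin k.
Cell : ℕ → Set
Cell k = Fin k × Fin k

data CactusAdj {k : ℕ} (δ : Fin k → Fin k) : Cell k → Cell k → Set where
  clique : ∀ i i' → i ≢ i' → CactusAdj δ (i , δ i) (i' , δ i')
  starˡ  : ∀ i j → j ≢ δ i → CactusAdj δ (i , δ i) (i , j)
  starʳ  : ∀ i j → j ≢ δ i → CactusAdj δ (i , j) (i , δ i)

Coloring : ℕ → Set
Coloring k = Cell k → Fin (suc k)

ProperColoring : ∀ {k} → (Fin k → Fin k) → Coloring k → Set
ProperColoring δ f = ∀ u v → CactusAdj δ u v → f u ≢ f v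

IsColoringFamily : ∀ k → List (Coloring k) → Set
IsColoringFamily k F = ∀ (δ : Fin k → Fin k) → Any (ProperColoring δ) F

module Submission where

-- Color cell (i , j) of the k × k table by (y i + j) mod (k + 1), for a shift vector
-- y ∈ [k+1]^k.  The colors in a row are then distinct, so this coloring is proper for the
-- cactus-grid graph of δ exactly when the k values (y i + δ i) mod (k + 1) are distinct.
-- Since translating by δ i permutes the residues, this happens for (k+1)! of the
-- N = (k+1)^k shift vectors, and N ≤ 4^(k+1) (k+1)! because n^n ≤ 4^n n!.  Choosing
-- greedily the shift vector that serves most of the still unserved maps δ therefore leaves
-- at most a fraction 1 - (k+1)!/N of them; by Bernoulli's inequality 4^(k+1) rounds halve
-- their number, so 4^(k+1) k² = 2^O(k) rounds serve all k^k < 2^(k²) maps.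

open import Defs
open import Data.Nat using (ℕ; _≤_; _^_; _*_)
open import Data.Product using (Σ; _×_)
open import Data.List using (List; length)

open import Data.Bool using (Bool; true; false; not; _∧_; _∨_; T)
open import Data.Bool.Properties using (T-∧)
open import Data.Empty using (⊥-elim)
open import Data.Fin using (Fin; zero; suc; toℕ; fromℕ<)
open import Data.Fin.Properties using (toℕ<n; toℕ-injective; fromℕ<-injective; toℕ-fromℕ<)
open import Data.List using ([]; _∷_; _++_; [_]; map; upTo; cartesianProductWith; filterᵇ)
open import Data.List.Extrema.Nat using (argmax; f[xs]≤f[argmax])
open import Data.List.Membership.Propositional using (_∈_; _∉_)
open import Data.List.Membership.Propositional.Properties using (∈-upTo⁺; ∈-upTo⁻; ∈-filter⁺; ∈-cartesianProductWith⁺)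
open import Data.List.Properties using (length-++; length-map; length-upTo; map-++; map-∘; map-upTo; map-applyUpTo; upTo-∷ʳ)
open import Data.List.Relation.Unary.All using (All; []; _∷_)
open import Data.List.Relation.Unary.Any using (Any; here; there)
import Data.List.Relation.Unary.Any as Any
open import Data.List.Relation.Unary.Any.Properties using (map⁺)
open import Data.Nat
open import Data.Nat.DivMod
open import Data.Nat.Divisibility using (_∣_; divides)
open import Data.Nat.ListAction using (sum)
open import Data.Nat.ListAction.Properties using (sum-++)
open import Data.Nat.Properties
open import Algebra.Properties.CommutativeSemigroup +-commutativeSemigroup using () renaming (interchange to +-interchange)
open import Algebra.Properties.CommutativeSemigroup *-commutativeSemigroup using (xy∙z≈xz∙y)
open import Data.Nat.Tactic.RingSolver using (solve-∀)
open import Data.List.Membership.DecPropositional _≟_ using (_∈?_; _∉?_)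
open import Data.Product using (Σ-syntax; _,_; proj₁; proj₂)
open import Data.Sum using (_⊎_; inj₁; inj₂)
open import Data.Unit using (tt)
open import Data.Vec using (Vec; []; _∷_; lookup; zipWith; tabulate; replicate)
open import Data.Vec.Properties using (lookup-zipWith; lookup∘tabulate)
import Data.Vec.Relation.Unary.All as Vec
open import Data.Vec.Relation.Unary.All.Properties using (tabulate⁺)
open import Function using (_∘_; Equivalence)
open import Relation.Nullary using (Dec; does; _because_; invert)
open import Relation.Nullary.Decidable using (T?)
open import Relation.Binary.PropositionalEquality using (_≡_; refl; sym; trans; cong; cong₂; subst; module ≡-Reasoning)

private variable A B C : Set

-- Elementary arithmetic

-- Bernoulli's inequality (1 + g/d)^(n+1) ≥ 1 + (n+1) g/d, multiplied by d^(n+1).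
bernoulli : ∀ d g n → d ^ n * (d + suc n * g) ≤ (d + g) ^ suc n
bernoulli d g zero = ≤-reflexive (base d g)
  where
  base : ∀ d g → 1 * (d + 1 * g) ≡ (d + g) * 1
  base = solve-∀
bernoulli d g (suc n) = begin
  d * d ^ n * (d + (g + x))           ≡⟨ regroup (d ^ n) d g x ⟩
  d ^ n * (d * (d + x) + d * g)       ≤⟨ *-monoʳ-≤ (d ^ n) (+-monoʳ-≤ (d * (d + x)) (*-monoˡ-≤ g (m≤m+n d x))) ⟩
  d ^ n * (d * (d + x) + (d + x) * g) ≡⟨ factor (d ^ n) d g (d + x) ⟩
  d ^ n * (d + x) * (d + g)           ≤⟨ *-monoˡ-≤ (d + g) (bernoulli d g n) ⟩
  (d + g) ^ suc n * (d + g)           ≡⟨ *-comm ((d + g) ^ suc n) (d + g) ⟩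
  (d + g) ^ suc (suc n)               ∎
  where
  open ≤-Reasoning
  x = suc n * g
  regroup : ∀ p d g x → d * p * (d + (g + x)) ≡ p * (d * (d + x) + d * g)
  regroup = solve-∀
  factor : ∀ p d g y → p * (d * y + y * g) ≡ p * y * (d + g)
  factor = solve-∀

[1+n]*[n∸h]≤n*[1+n∸h] : ∀ n h → suc n * (n ∸ h) ≤ n * (suc n ∸ h)
[1+n]*[n∸h]≤n*[1+n∸h] n zero = ≤-reflexive (*-comm (suc n) n)
[1+n]*[n∸h]≤n*[1+n∸h] zero (suc h) = z≤n
[1+n]*[n∸h]≤n*[1+n∸h] (suc n) (suc h) = begin
  (n ∸ h) + suc n * (n ∸ h)       ≤⟨ +-mono-≤ (∸-monoˡ-≤ h (n≤1+n n)) ([1+n]*[n∸h]≤n*[1+n∸h] n h) ⟩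
  (suc n ∸ h) + n * (suc n ∸ h)   ∎
  where open ≤-Reasoning

-- Bernoulli's inequality (1 - 1/(n+1))^h ≥ 1 - h/(n+1).
[1+n]^h*[1+n∸h]≤n^h*[1+n] : ∀ n h → suc n ^ h * (suc n ∸ h) ≤ n ^ h * suc n
[1+n]^h*[1+n∸h]≤n^h*[1+n] n zero = ≤-refl
[1+n]^h*[1+n∸h]≤n^h*[1+n] n (suc h) = begin
  suc n * suc n ^ h * (n ∸ h)     ≡⟨ swap (suc n) (suc n ^ h) (n ∸ h) ⟩
  suc n ^ h * (suc n * (n ∸ h))   ≤⟨ *-monoʳ-≤ (suc n ^ h) ([1+n]*[n∸h]≤n*[1+n∸h] n h) ⟩
  suc n ^ h * (n * (suc n ∸ h))   ≡⟨ swap′ (suc n ^ h) n (suc n ∸ h) ⟩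
  n * (suc n ^ h * (suc n ∸ h))   ≤⟨ *-monoʳ-≤ n ([1+n]^h*[1+n∸h]≤n^h*[1+n] n h) ⟩
  n * (n ^ h * suc n)             ≡⟨ *-assoc n (n ^ h) (suc n) ⟨
  n * n ^ h * suc n               ∎
  where
  open ≤-Reasoning
  swap : ∀ a b c → a * b * c ≡ b * (a * c)
  swap = solve-∀
  swap′ : ∀ a b c → a * (b * c) ≡ b * (a * c)
  swap′ = solve-∀

[1+n]^h≤2*n^h : ∀ n h → h + h ≤ suc n → suc n ^ h ≤ 2 * n ^ h
[1+n]^h≤2*n^h n h h+h≤1+n = *-cancelʳ-≤ (suc n ^ h) (2 * n ^ h) (suc n) (begin
  suc n ^ h * suc n               ≤⟨ *-monoʳ-≤ (suc n ^ h) 1+n≤2*[1+n∸h] ⟩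
  suc n ^ h * (2 * (suc n ∸ h))   ≡⟨ swap (suc n ^ h) (suc n ∸ h) ⟩
  2 * (suc n ^ h * (suc n ∸ h))   ≤⟨ *-monoʳ-≤ 2 ([1+n]^h*[1+n∸h]≤n^h*[1+n] n h) ⟩
  2 * (n ^ h * suc n)             ≡⟨ *-assoc 2 (n ^ h) (suc n) ⟨
  2 * n ^ h * suc n               ∎)
  where
  open ≤-Reasoning
  swap : ∀ a b → a * (2 * b) ≡ 2 * (a * b)
  swap = solve-∀
  1+n≤2*[1+n∸h] : suc n ≤ 2 * (suc n ∸ h)
  1+n≤2*[1+n∸h] = begin
    suc n                       ≡⟨ m+[n∸m]≡n (≤-trans (m≤m+n h h) h+h≤1+n) ⟨
    h + (suc n ∸ h)             ≤⟨ +-monoˡ-≤ (suc n ∸ h) (m+n≤o⇒m≤o∸n h h+h≤1+n) ⟩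
    (suc n ∸ h) + (suc n ∸ h)   ≡⟨ cong ((suc n ∸ h) +_) (+-identityʳ (suc n ∸ h)) ⟨
    2 * (suc n ∸ h)             ∎

⌊n/2⌋+⌊n/2⌋≤n : ∀ n → ⌊ n /2⌋ + ⌊ n /2⌋ ≤ n
⌊n/2⌋+⌊n/2⌋≤n n = ≤-trans (+-monoʳ-≤ ⌊ n /2⌋ (⌊n/2⌋≤⌈n/2⌉ n)) (≤-reflexive (⌊n/2⌋+⌈n/2⌉≡n n))

[1+n]^n≤4*n^n : ∀ n → suc n ^ n ≤ 4 * n ^ n
[1+n]^n≤4*n^n n = begin
  suc n ^ n                          ≡⟨ cong (suc n ^_) (⌊n/2⌋+⌈n/2⌉≡n n) ⟨
  suc n ^ (a + b)                    ≡⟨ ^-distribˡ-+-* (suc n) a b ⟩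
  suc n ^ a * suc n ^ b              ≤⟨ *-mono-≤ (half a (≤-trans (⌊n/2⌋+⌊n/2⌋≤n n) (n≤1+n n)))
                                                 (half b (⌊n/2⌋+⌊n/2⌋≤n (suc n))) ⟩
  (2 * n ^ a) * (2 * n ^ b)          ≡⟨ regroup (n ^ a) (n ^ b) ⟩
  4 * (n ^ a * n ^ b)                ≡⟨ cong (4 *_) (^-distribˡ-+-* n a b) ⟨
  4 * n ^ (a + b)                    ≡⟨ cong (λ e → 4 * n ^ e) (⌊n/2⌋+⌈n/2⌉≡n n) ⟩
  4 * n ^ n                          ∎
  where
  open ≤-Reasoning
  a = ⌊ n /2⌋
  b = ⌈ n /2⌉
  half : ∀ h → h + h ≤ suc n → suc n ^ h ≤ 2 * n ^ h
  half = [1+n]^h≤2*n^h n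
  regroup : ∀ x y → (2 * x) * (2 * y) ≡ 4 * (x * y)
  regroup = solve-∀

n^n≤4^n*n! : ∀ n → n ^ n ≤ 4 ^ n * n !
n^n≤4^n*n! zero = ≤-refl
n^n≤4^n*n! (suc n) = begin
  suc n * suc n ^ n             ≤⟨ *-monoʳ-≤ (suc n) ([1+n]^n≤4*n^n n) ⟩
  suc n * (4 * n ^ n)           ≤⟨ *-monoʳ-≤ (suc n) (*-monoʳ-≤ 4 (n^n≤4^n*n! n)) ⟩
  suc n * (4 * (4 ^ n * n !))   ≡⟨ regroup (suc n) (4 ^ n) (n !) ⟩
  4 * 4 ^ n * (suc n * n !)     ∎
  where
  open ≤-Reasoning
  regroup : ∀ a b c → a * (4 * (b * c)) ≡ 4 * b * (a * c)
  regroup = solve-∀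

[1+n]!≤[1+n]^n : ∀ n → suc n ! ≤ suc n ^ n
[1+n]!≤[1+n]^n zero    = ≤-refl
[1+n]!≤[1+n]^n (suc n) = *-monoʳ-≤ (suc (suc n)) (≤-trans ([1+n]!≤[1+n]^n n) (^-monoˡ-≤ n (n≤1+n (suc n))))

n<2^n : ∀ n → n < 2 ^ n
n<2^n zero    = z<s
n<2^n (suc n) = begin-strict
  suc n          ≤⟨ n<2^n n ⟩
  2 ^ n          <⟨ m<m+n (2 ^ n) (m^n>0 2 n) ⟩
  2 ^ n + 2 ^ n  ≡⟨ cong (2 ^ n +_) (+-identityʳ (2 ^ n)) ⟨
  2 ^ suc n      ∎
  where open ≤-Reasoning

^-distribʳ-* : ∀ m n o → (m * n) ^ o ≡ m ^ o * n ^ o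
^-distribʳ-* m n zero    = refl
^-distribʳ-* m n (suc o) = trans (cong (m * n *_) (^-distribʳ-* m n o)) (regroup m n (m ^ o) (n ^ o))
  where
  regroup : ∀ a b c d → a * b * (c * d) ≡ a * c * (b * d)
  regroup = solve-∀

[n∸g]^l*2≤n^l : ∀ n g l .{{_ : NonZero n}} → g ≤ n → n ≤ l * g → (n ∸ g) ^ l * 2 ≤ n ^ l
[n∸g]^l*2≤n^l n g l g≤n n≤l*g = *-cancelʳ-≤ ((n ∸ g) ^ l * 2) (n ^ l) n (begin
  (n ∸ g) ^ l * 2 * n                 ≡⟨ *-assoc ((n ∸ g) ^ l) 2 n ⟩
  (n ∸ g) ^ l * (n + (n + 0))         ≤⟨ *-monoʳ-≤ ((n ∸ g) ^ l) (+-mono-≤ (≤-reflexive (sym (m∸n+n≡m g≤n))) (≤-trans (≤-reflexive (+-identityʳ n)) n≤l*g)) ⟩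
  (n ∸ g) ^ l * ((n ∸ g) + g + l * g) ≡⟨ cong ((n ∸ g) ^ l *_) (+-assoc (n ∸ g) g (l * g)) ⟩
  (n ∸ g) ^ l * ((n ∸ g) + suc l * g) ≤⟨ bernoulli (n ∸ g) g l ⟩
  ((n ∸ g) + g) ^ suc l               ≡⟨ cong (_^ suc l) (m∸n+n≡m g≤n) ⟩
  n * n ^ l                           ≡⟨ *-comm n (n ^ l) ⟩
  n ^ l * n                           ∎)
  where open ≤-Reasoning

m<n∧n*o≤p⇒m*o<p : ∀ {m n o p} → m < n → n * o ≤ p → 0 < p → m * o < p
m<n∧n*o≤p⇒m*o<p {m} {n} {zero} {p} _ _ 0<p = subst (_< p) (sym (*-zeroʳ m)) 0<p
m<n∧n*o≤p⇒m*o<p {m} {n} {suc o} m<n n*o≤p _ = <-≤-trans (*-monoˡ-< (suc o) m<n) n*o≤p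

s*[n∸g]^[l*e]<n^[l*e] : ∀ s n g l e .{{_ : NonZero n}} → s < 2 ^ e → g ≤ n → n ≤ l * g →
                        s * (n ∸ g) ^ (l * e) < n ^ (l * e)
s*[n∸g]^[l*e]<n^[l*e] s n g l e s<2^e g≤n n≤l*g = m<n∧n*o≤p⇒m*o<p s<2^e (begin
  2 ^ e * (n ∸ g) ^ (l * e)     ≡⟨ *-comm (2 ^ e) ((n ∸ g) ^ (l * e)) ⟩
  (n ∸ g) ^ (l * e) * 2 ^ e     ≡⟨ cong (_* 2 ^ e) (^-*-assoc (n ∸ g) l e) ⟨
  ((n ∸ g) ^ l) ^ e * 2 ^ e     ≡⟨ ^-distribʳ-* ((n ∸ g) ^ l) 2 e ⟨
  ((n ∸ g) ^ l * 2) ^ e         ≤⟨ ^-monoˡ-≤ e ([n∸g]^l*2≤n^l n g l g≤n n≤l*g) ⟩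
  (n ^ l) ^ e                   ≡⟨ ^-*-assoc n l e ⟩
  n ^ (l * e)                   ∎) (m^n>0 n (l * e))
  where open ≤-Reasoning

[m+n%d]%d≡[m+n]%d : ∀ m n d .{{_ : NonZero d}} → (m + n % d) % d ≡ (m + n) % d
[m+n%d]%d≡[m+n]%d m n d = begin
  (m + n % d) % d          ≡⟨ %-distribˡ-+ m (n % d) d ⟩
  (m % d + n % d % d) % d  ≡⟨ cong (λ x → (m % d + x) % d) (m%n%n≡m%n n d) ⟩
  (m % d + n % d) % d      ≡⟨ %-distribˡ-+ m n d ⟨
  (m + n) % d              ∎
  where open ≡-Reasoning

-- Adding d ∸ a % d undoes adding a.
%-+-cancelˡ : ∀ d .{{_ : NonZero d}} a {b c} → (a + b) % d ≡ (a + c) % d → b % d ≡ c % d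
%-+-cancelˡ d a {b} {c} eq = trans (sym (undo b)) (trans (cong (λ x → (a⁻ + x) % d) eq) (undo c))
  where
  a⁻ = d ∸ a % d
  d∣a⁻+a : d ∣ a⁻ + a
  d∣a⁻+a = divides (suc (a / d)) (begin
    a⁻ + a                      ≡⟨ cong (a⁻ +_) (m≡m%n+[m/n]*n a d) ⟩
    a⁻ + (a % d + a / d * d)    ≡⟨ +-assoc a⁻ (a % d) (a / d * d) ⟨
    a⁻ + a % d + a / d * d      ≡⟨ cong (_+ a / d * d) (m∸n+n≡m (m%n≤n a d)) ⟩
    suc (a / d) * d             ∎)
    where open ≡-Reasoning
  undo : ∀ b → (a⁻ + (a + b) % d) % d ≡ b % d
  undo b = begin
    (a⁻ + (a + b) % d) % d  ≡⟨ [m+n%d]%d≡[m+n]%d a⁻ (a + b) d ⟩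
    (a⁻ + (a + b)) % d      ≡⟨ cong (_% d) (+-assoc a⁻ a b) ⟨
    (a⁻ + a + b) % d        ≡⟨ %-remove-+ˡ b d∣a⁻+a ⟩
    b % d                   ∎
    where open ≡-Reasoning

-- Sums over lists

∑ : List A → (A → ℕ) → ℕ
∑ xs f = sum (map f xs)

syntax ∑ xs (λ x → e) = ∑[ x ∈ xs ] e

∑-++ : ∀ xs ys (f : A → ℕ) → ∑ (xs ++ ys) f ≡ ∑ xs f + ∑ ys f
∑-++ xs ys f = trans (cong sum (map-++ f xs ys)) (sum-++ (map f xs) (map f ys))

∑-map : ∀ (g : A → B) xs (f : B → ℕ) → ∑ (map g xs) f ≡ ∑ xs (f ∘ g)
∑-map g xs f = cong sum (sym (map-∘ xs))

∑-cong : ∀ xs {f g : A → ℕ} → (∀ {x} → x ∈ xs → f x ≡ g x) → ∑ xs f ≡ ∑ xs g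
∑-cong []       eq = refl
∑-cong (x ∷ xs) eq = cong₂ _+_ (eq (here refl)) (∑-cong xs (eq ∘ there))

∑-mono : ∀ xs {f g : A → ℕ} → (∀ x → f x ≤ g x) → ∑ xs f ≤ ∑ xs g
∑-mono []       le = z≤n
∑-mono (x ∷ xs) le = +-mono-≤ (le x) (∑-mono xs le)

∑-const : ∀ (xs : List A) c → ∑[ x ∈ xs ] c ≡ length xs * c
∑-const []       c = refl
∑-const (x ∷ xs) c = cong (c +_) (∑-const xs c)

∑-≤-const : ∀ {xs} {f : A → ℕ} {c} → All (λ x → f x ≤ c) xs → ∑ xs f ≤ length xs * c
∑-≤-const []         = z≤n
∑-≤-const (le ∷ les) = +-mono-≤ le (∑-≤-const les)

∑-*ʳ : ∀ xs (f : A → ℕ) c → ∑[ x ∈ xs ] (f x * c) ≡ ∑ xs f * c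
∑-*ʳ []       f c = refl
∑-*ʳ (x ∷ xs) f c = trans (cong (f x * c +_) (∑-*ʳ xs f c)) (sym (*-distribʳ-+ c (f x) (∑ xs f)))

∑-distrib-+ : ∀ xs (f g : A → ℕ) → ∑[ x ∈ xs ] (f x + g x) ≡ ∑ xs f + ∑ xs g
∑-distrib-+ []       f g = refl
∑-distrib-+ (x ∷ xs) f g = trans (cong (f x + g x +_) (∑-distrib-+ xs f g)) (+-interchange (f x) (g x) _ _)

∑-comm : ∀ (xs : List A) (ys : List B) (f : A → B → ℕ) →
         ∑[ x ∈ xs ] ∑[ y ∈ ys ] f x y ≡ ∑[ y ∈ ys ] ∑[ x ∈ xs ] f x y
∑-comm []       ys f = trans (sym (*-zeroʳ (length ys))) (sym (∑-const ys 0))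
∑-comm (x ∷ xs) ys f = trans (cong (∑ ys (f x) +_) (∑-comm xs ys f)) (sym (∑-distrib-+ ys (f x) _))

∑-cartesianProductWith : ∀ (g : A → B → C) xs ys (f : C → ℕ) →
  ∑ (cartesianProductWith g xs ys) f ≡ ∑[ x ∈ xs ] ∑[ y ∈ ys ] f (g x y)
∑-cartesianProductWith g []       ys f = refl
∑-cartesianProductWith g (x ∷ xs) ys f = begin
  ∑ (map (g x) ys ++ cartesianProductWith g xs ys) f   ≡⟨ ∑-++ (map (g x) ys) _ f ⟩
  ∑ (map (g x) ys) f + ∑ (cartesianProductWith g xs ys) f ≡⟨ cong₂ _+_ (∑-map (g x) ys f) (∑-cartesianProductWith g xs ys f) ⟩
  ∑[ y ∈ ys ] f (g x y) + ∑[ x ∈ xs ] ∑[ y ∈ ys ] f (g x y) ∎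
  where open ≡-Reasoning

∑-upTo-suc : ∀ n (f : ℕ → ℕ) → ∑ (upTo (suc n)) f ≡ f 0 + ∑[ y ∈ upTo n ] f (suc y)
∑-upTo-suc n f = cong (λ xs → f 0 + sum xs) (trans (map-applyUpTo suc f n) (sym (map-upTo (f ∘ suc) n)))

∑-upTo-∷ʳ : ∀ n (f : ℕ → ℕ) → ∑ (upTo (suc n)) f ≡ ∑ (upTo n) f + f n
∑-upTo-∷ʳ n f = begin
  ∑ (upTo (suc n)) f     ≡⟨ cong (λ xs → ∑ xs f) (upTo-∷ʳ n) ⟨
  ∑ (upTo n ++ [ n ]) f  ≡⟨ ∑-++ (upTo n) [ n ] f ⟩
  ∑ (upTo n) f + (f n + 0) ≡⟨ cong (∑ (upTo n) f +_) (+-identityʳ (f n)) ⟩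
  ∑ (upTo n) f + f n     ∎
  where open ≡-Reasoning

∑-upTo-rotate : ∀ n (h : ℕ → ℕ) → h n ≡ h 0 → ∑[ y ∈ upTo n ] h (suc y) ≡ ∑ (upTo n) h
∑-upTo-rotate zero    h eq = refl
∑-upTo-rotate (suc n) h eq = begin
  ∑[ y ∈ upTo (suc n) ] h (suc y)       ≡⟨ ∑-upTo-∷ʳ n (h ∘ suc) ⟩
  ∑[ y ∈ upTo n ] h (suc y) + h (suc n) ≡⟨ cong (∑[ y ∈ upTo n ] h (suc y) +_) eq ⟩
  ∑[ y ∈ upTo n ] h (suc y) + h 0       ≡⟨ +-comm _ (h 0) ⟩
  h 0 + ∑[ y ∈ upTo n ] h (suc y)       ≡⟨ ∑-upTo-suc n h ⟨
  ∑ (upTo (suc n)) h                    ∎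
  where open ≡-Reasoning

∑-upTo-periodic : ∀ n (f : ℕ → ℕ) → (∀ x → f (x + n) ≡ f x) →
                  ∀ u → ∑[ y ∈ upTo n ] f (y + u) ≡ ∑ (upTo n) f
∑-upTo-periodic n f periodic zero    = ∑-cong (upTo n) (λ {y} _ → cong f (+-identityʳ y))
∑-upTo-periodic n f periodic (suc u) = begin
  ∑[ y ∈ upTo n ] f (y + suc u)  ≡⟨ ∑-cong (upTo n) (λ {y} _ → cong f (+-suc y u)) ⟩
  ∑[ y ∈ upTo n ] f (suc y + u)  ≡⟨ ∑-upTo-rotate n (λ y → f (y + u)) (trans (cong f (+-comm n u)) (periodic u)) ⟩
  ∑[ y ∈ upTo n ] f (y + u)      ≡⟨ ∑-upTo-periodic n f periodic u ⟩
  ∑ (upTo n) f                   ∎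
  where open ≡-Reasoning

∑-upTo-shift : ∀ n .{{_ : NonZero n}} (g : ℕ → ℕ) u → ∑[ y ∈ upTo n ] g ((y + u) % n) ≡ ∑ (upTo n) g
∑-upTo-shift n g u = begin
  ∑[ y ∈ upTo n ] g ((y + u) % n)  ≡⟨ ∑-upTo-periodic n (λ x → g (x % n)) (λ x → cong g ([m+n]%n≡m%n x n)) u ⟩
  ∑[ y ∈ upTo n ] g (y % n)        ≡⟨ ∑-cong (upTo n) (λ y∈ → cong g (m<n⇒m%n≡m (∈-upTo⁻ y∈))) ⟩
  ∑ (upTo n) g                     ∎
  where open ≡-Reasoning

𝟙 : Bool → ℕ
𝟙 true  = 1
𝟙 false = 0

𝟙-not-∨ : ∀ x y → 𝟙 (not y) ≤ 𝟙 (not (x ∨ y)) + 𝟙 x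
𝟙-not-∨ true  y = 𝟙≤1 (not y)
  where
  𝟙≤1 : ∀ b → 𝟙 b ≤ 1
  𝟙≤1 true  = ≤-refl
  𝟙≤1 false = z≤n
𝟙-not-∨ false y = m≤m+n _ 0

∑-≡ᵇ-upTo≤1 : ∀ n a → ∑[ z ∈ upTo n ] 𝟙 (z ≡ᵇ a) ≤ 1
∑-≡ᵇ-upTo≤1 zero    a       = z≤n
∑-≡ᵇ-upTo≤1 (suc n) a = ≤-trans (≤-reflexive (∑-upTo-suc n (λ z → 𝟙 (z ≡ᵇ a)))) (split a)
  where
  split : ∀ a → 𝟙 (0 ≡ᵇ a) + ∑[ z ∈ upTo n ] 𝟙 (suc z ≡ᵇ a) ≤ 1
  split zero    = s≤s (≤-reflexive (trans (∑-const (upTo n) 0) (*-zeroʳ (length (upTo n)))))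
  split (suc a) = ∑-≡ᵇ-upTo≤1 n a

∑-∉-upTo : ∀ n (taken : List ℕ) → n ≤ ∑[ z ∈ upTo n ] 𝟙 (does (z ∉? taken)) + length taken
∑-∉-upTo n [] = ≤-reflexive (sym (begin
  ∑[ z ∈ upTo n ] 1 + 0   ≡⟨ +-identityʳ _ ⟩
  ∑[ z ∈ upTo n ] 1       ≡⟨ ∑-const (upTo n) 1 ⟩
  length (upTo n) * 1     ≡⟨ *-identityʳ _ ⟩
  length (upTo n)         ≡⟨ length-upTo n ⟩
  n                       ∎))
  where open ≡-Reasoning
∑-∉-upTo n (a ∷ taken) = begin
  n                                                            ≤⟨ ∑-∉-upTo n taken ⟩
  ∑[ z ∈ upTo n ] 𝟙 (does (z ∉? taken)) + length taken          ≤⟨ +-monoˡ-≤ (length taken) (∑-mono (upTo n) split) ⟩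
  ∑[ z ∈ upTo n ] (𝟙 (does (z ∉? a ∷ taken)) + 𝟙 (z ≡ᵇ a)) + length taken
                                                               ≡⟨ cong (_+ length taken) (∑-distrib-+ (upTo n) _ _) ⟩
  (free + ∑[ z ∈ upTo n ] 𝟙 (z ≡ᵇ a)) + length taken            ≤⟨ +-monoˡ-≤ (length taken) (+-monoʳ-≤ free (∑-≡ᵇ-upTo≤1 n a)) ⟩
  (free + 1) + length taken                                    ≡⟨ +-assoc free 1 (length taken) ⟩
  free + suc (length taken)                                    ∎
  where
  open ≤-Reasoning
  free = ∑[ z ∈ upTo n ] 𝟙 (does (z ∉? a ∷ taken))
  split : ∀ z → 𝟙 (does (z ∉? taken)) ≤ 𝟙 (does (z ∉? a ∷ taken)) + 𝟙 (z ≡ᵇ a)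
  split z = 𝟙-not-∨ (z ≡ᵇ a) (does (z ∈? taken))

-- Greedy covering

length-filterᵇ-not : ∀ (p : A → Bool) xs → length (filterᵇ (not ∘ p) xs) + ∑[ x ∈ xs ] 𝟙 (p x) ≡ length xs
length-filterᵇ-not p []       = refl
length-filterᵇ-not p (x ∷ xs) with p x
... | true  = trans (+-suc _ _) (cong suc (length-filterᵇ-not p xs))
... | false = cong suc (length-filterᵇ-not p xs)

∈-filterᵇ-not : ∀ (p : A → Bool) {x xs} → x ∈ xs → T (p x) ⊎ x ∈ filterᵇ (not ∘ p) xs
∈-filterᵇ-not p {x} x∈xs with p x in eq
... | true  = inj₁ tt
... | false = inj₂ (∈-filter⁺ (T? ∘ not ∘ p) x∈xs (subst (T ∘ not) (sym eq) tt))

module GreedyCover (hit : B → A → Bool) (candidates : List A) (a₀ : A) (G : ℕ)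
                   (hit-often : ∀ b → G ≤ ∑[ a ∈ candidates ] 𝟙 (hit b a)) where

  N : ℕ
  N = length candidates

  hits : List B → A → ℕ
  hits S a = ∑[ b ∈ S ] 𝟙 (hit b a)

  missed : A → List B → List B
  missed a = filterᵇ (λ b → not (hit b a))

  best : List B → A
  best S = argmax (hits S) a₀ candidates

  hits-best : ∀ S → length S * G ≤ N * hits S (best S)
  hits-best S = begin
    length S * G                                  ≡⟨ ∑-const S G ⟨
    ∑[ b ∈ S ] G                                  ≤⟨ ∑-mono S hit-often ⟩
    ∑[ b ∈ S ] ∑[ a ∈ candidates ] 𝟙 (hit b a)    ≡⟨ ∑-comm S candidates (λ b a → 𝟙 (hit b a)) ⟩
    ∑ candidates (hits S)                         ≤⟨ ∑-≤-const (f[xs]≤f[argmax] a₀ candidates) ⟩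
    N * hits S (best S)                           ∎
    where open ≤-Reasoning

  missed-best : ∀ S → length (missed (best S) S) * N ≤ length S * (N ∸ G)
  missed-best S = begin
    r * N                         ≤⟨ m+n≤o⇒m≤o∸n (r * N) r*N+|S|*G≤|S|*N ⟩
    length S * N ∸ length S * G   ≡⟨ *-distribˡ-∸ (length S) N G ⟨
    length S * (N ∸ G)            ∎
    where
    open ≤-Reasoning
    r = length (missed (best S) S)
    h = hits S (best S)
    r*N+|S|*G≤|S|*N : r * N + length S * G ≤ length S * N
    r*N+|S|*G≤|S|*N = begin
      r * N + length S * G  ≤⟨ +-monoʳ-≤ (r * N) (hits-best S) ⟩
      r * N + N * h         ≡⟨ cong (r * N +_) (*-comm N h) ⟩
      r * N + h * N         ≡⟨ *-distribʳ-+ N r h ⟨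
      (r + h) * N           ≡⟨ cong (_* N) (length-filterᵇ-not (λ b → hit b (best S)) S) ⟩
      length S * N          ∎

  greedyCover : ∀ t S → length S * (N ∸ G) ^ t < N ^ t →
                Σ[ Z ∈ List A ] length Z ≡ t × (∀ {b} → b ∈ S → Any (T ∘ hit b) Z)
  greedyCover zero    []      _         = [] , refl , λ ()
  greedyCover zero    (_ ∷ _) (s≤s ())
  greedyCover (suc t) S       few-left  = best S ∷ Z , cong suc |Z|≡t , covers
    where
    open ≤-Reasoning
    D = N ∸ G
    S′ = missed (best S) S
    fewer-left : length S′ * D ^ t < N ^ t
    fewer-left = *-cancelʳ-< N (length S′ * D ^ t) (N ^ t) (begin-strict
      length S′ * D ^ t * N    ≡⟨ xy∙z≈xz∙y (length S′) (D ^ t) N ⟩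
      length S′ * N * D ^ t    ≤⟨ *-monoˡ-≤ (D ^ t) (missed-best S) ⟩
      length S * D * D ^ t     ≡⟨ *-assoc (length S) D (D ^ t) ⟩
      length S * D ^ suc t     <⟨ few-left ⟩
      N * N ^ t                ≡⟨ *-comm N (N ^ t) ⟩
      N ^ t * N                ∎)
    rest = greedyCover t S′ fewer-left
    Z = proj₁ rest
    |Z|≡t = proj₁ (proj₂ rest)
    covers : ∀ {b} → b ∈ S → Any (T ∘ hit b) (best S ∷ Z)
    covers b∈S with ∈-filterᵇ-not (λ b → hit b (best S)) b∈S
    ... | inj₁ hit-best = here hit-best
    ... | inj₂ b∈S′     = there (proj₂ (proj₂ rest) b∈S′)

-- Shift colorings

length-cartesianProductWith : ∀ (f : A → B → C) xs ys →
  length (cartesianProductWith f xs ys) ≡ length xs * length ys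
length-cartesianProductWith f []       ys = refl
length-cartesianProductWith f (x ∷ xs) ys = begin
  length (map (f x) ys ++ cartesianProductWith f xs ys)        ≡⟨ length-++ (map (f x) ys) ⟩
  length (map (f x) ys) + length (cartesianProductWith f xs ys) ≡⟨ cong₂ _+_ (length-map (f x) ys) (length-cartesianProductWith f xs ys) ⟩
  length ys + length xs * length ys                            ∎
  where open ≡-Reasoning

vectors : ℕ → ∀ n → List (Vec ℕ n)
vectors m zero    = [ [] ]
vectors m (suc n) = cartesianProductWith _∷_ (upTo m) (vectors m n)

length-vectors : ∀ m n → length (vectors m n) ≡ m ^ n
length-vectors m zero    = refl
length-vectors m (suc n) = trans (length-cartesianProductWith _∷_ (upTo m) (vectors m n))
                                 (cong₂ _*_ (length-upTo m) (length-vectors m n))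

∈-vectors : ∀ {m n} {v : Vec ℕ n} → Vec.All (_< m) v → v ∈ vectors m n
∈-vectors Vec.[]            = here refl
∈-vectors (x<m Vec.∷ v<m) = ∈-cartesianProductWith⁺ _∷_ (∈-upTo⁺ x<m) (∈-vectors v<m)

fresh : List ℕ → ∀ {n} → Vec ℕ n → Bool
fresh taken []       = true
fresh taken (z ∷ zs) = does (z ∉? taken) ∧ fresh (z ∷ taken) zs

fresh-∷⁻ : ∀ taken z {n} (zs : Vec ℕ n) → T (fresh taken (z ∷ zs)) → z ∉ taken × T (fresh (z ∷ taken) zs)
fresh-∷⁻ taken z zs ok with ok₁ , ok₂ ← Equivalence.to (T-∧ {does (z ∉? taken)}) ok = T-does⇒ (z ∉? taken) ok₁ , ok₂
  where
  T-does⇒ : ∀ {P : Set} (p? : Dec P) → T (does p?) → P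
  T-does⇒ (true because [p]) _ = invert [p]

fresh⇒∉ : ∀ taken {n} (zs : Vec ℕ n) → T (fresh taken zs) → ∀ i → lookup zs i ∉ taken
fresh⇒∉ taken (z ∷ zs) ok zero    = proj₁ (fresh-∷⁻ taken z zs ok)
fresh⇒∉ taken (z ∷ zs) ok (suc i) = fresh⇒∉ (z ∷ taken) zs (proj₂ (fresh-∷⁻ taken z zs ok)) i ∘ there

fresh⇒lookup-injective : ∀ taken {n} (zs : Vec ℕ n) → T (fresh taken zs) → ∀ i j → lookup zs i ≡ lookup zs j → i ≡ j
fresh⇒lookup-injective taken (z ∷ zs) ok zero    zero    eq = refl
fresh⇒lookup-injective taken (z ∷ zs) ok zero    (suc j) eq = ⊥-elim (fresh⇒∉ (z ∷ taken) zs (proj₂ (fresh-∷⁻ taken z zs ok)) j (here (sym eq)))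
fresh⇒lookup-injective taken (z ∷ zs) ok (suc i) zero    eq = ⊥-elim (fresh⇒∉ (z ∷ taken) zs (proj₂ (fresh-∷⁻ taken z zs ok)) i (here eq))
fresh⇒lookup-injective taken (z ∷ zs) ok (suc i) (suc j) eq = cong suc (fresh⇒lookup-injective (z ∷ taken) zs (proj₂ (fresh-∷⁻ taken z zs ok)) i j eq)

module _ (m : ℕ) .{{_ : NonZero m}} where

  shift : ∀ {n} → Vec ℕ n → Vec ℕ n → Vec ℕ n
  shift = zipWith (λ y u → (y + u) % m)

  -- As y runs over the residues, so does (y + u) % m; at least n + 2 of them are not taken.
  fresh-shifts : ∀ n taken (u : Vec ℕ n) → length taken + n < m →
                 suc n ! ≤ ∑[ y ∈ vectors m n ] 𝟙 (fresh taken (shift y u))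
  fresh-shifts zero    taken []       _    = ≤-refl
  fresh-shifts (suc n) taken (u ∷ us) room = begin
    suc (suc n) * suc n !                                          ≤⟨ *-monoˡ-≤ (suc n !) 2+n≤∑notTaken ⟩
    ∑[ z ∈ upTo m ] 𝟙 (does (z ∉? taken)) * suc n !                ≡⟨ cong (_* suc n !) (∑-upTo-shift m notTaken u) ⟨
    ∑[ y ∈ upTo m ] notTaken ((y + u) % m) * suc n !                  ≡⟨ ∑-*ʳ (upTo m) (λ y → notTaken ((y + u) % m)) (suc n !) ⟨
    ∑[ y ∈ upTo m ] (notTaken ((y + u) % m) * suc n !)                ≤⟨ ∑-mono (upTo m) (λ y → extend ((y + u) % m)) ⟩
    ∑[ y ∈ upTo m ] ∑[ ys ∈ vectors m n ] 𝟙 (fresh taken (shift (y ∷ ys) (u ∷ us)))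
                                                                   ≡⟨ ∑-cartesianProductWith _∷_ (upTo m) (vectors m n) _ ⟨
    ∑[ y ∈ vectors m (suc n) ] 𝟙 (fresh taken (shift y (u ∷ us)))  ∎
    where
    open ≤-Reasoning
    notTaken : ℕ → ℕ
    notTaken z = 𝟙 (does (z ∉? taken))
    2+n≤∑notTaken : suc (suc n) ≤ ∑ (upTo m) notTaken
    2+n≤∑notTaken = +-cancelʳ-≤ (length taken) (suc (suc n)) _ (begin
      suc (suc n) + length taken          ≡⟨ cong suc (+-comm (suc n) (length taken)) ⟩
      suc (length taken + suc n)          ≤⟨ room ⟩
      m                                   ≤⟨ ∑-∉-upTo m taken ⟩
      ∑ (upTo m) notTaken + length taken     ∎)
    room′ : ∀ z → length (z ∷ taken) + n < m
    room′ z = ≤-trans (≤-reflexive (cong suc (sym (+-suc (length taken) n)))) room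
    extend : ∀ z → notTaken z * suc n ! ≤ ∑[ ys ∈ vectors m n ] 𝟙 (does (z ∉? taken) ∧ fresh (z ∷ taken) (shift ys us))
    extend z with does (z ∉? taken)
    ... | true  = ≤-trans (≤-reflexive (+-identityʳ (suc n !))) (fresh-shifts n (z ∷ taken) us (room′ z))
    ... | false = z≤n

shiftColoring : ∀ {k} → Vec ℕ k → Coloring k
shiftColoring {k} y (i , j) = fromℕ< (m%n<n (lookup y i + toℕ j) (suc k))

toℕ-shiftColoring : ∀ {k} (y : Vec ℕ k) i j → toℕ (shiftColoring y (i , j)) ≡ (lookup y i + toℕ j) % suc k
toℕ-shiftColoring {k} y i j = toℕ-fromℕ< (m%n<n (lookup y i + toℕ j) (suc k))

shiftColoring-injectiveʳ : ∀ {k} (y : Vec ℕ k) i {j j′} → shiftColoring y (i , j) ≡ shiftColoring y (i , j′) → j ≡ j′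
shiftColoring-injectiveʳ {k} y i {j} {j′} eq = toℕ-injective (begin
  toℕ j                ≡⟨ m<n⇒m%n≡m (m<n⇒m<1+n (toℕ<n j)) ⟨
  toℕ j % suc k        ≡⟨ %-+-cancelˡ (suc k) (lookup y i) (fromℕ<-injective _ _ _ _ eq) ⟩
  toℕ j′ % suc k       ≡⟨ m<n⇒m%n≡m (m<n⇒m<1+n (toℕ<n j′)) ⟩
  toℕ j′               ∎)
  where open ≡-Reasoning

shiftColoring-proper : ∀ {k} (δ : Fin k → Fin k) (y : Vec ℕ k) →
                       T (fresh [] (shift (suc k) y (tabulate (toℕ ∘ δ)))) → ProperColoring δ (shiftColoring y)
shiftColoring-proper {k} δ y ok _ _ (clique i i′ i≢i′) eq =
  i≢i′ (fresh⇒lookup-injective [] (shift (suc k) y u) ok i i′ (begin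
    lookup (shift (suc k) y u) i          ≡⟨ entry i ⟩
    toℕ (shiftColoring y (i , δ i))       ≡⟨ cong toℕ eq ⟩
    toℕ (shiftColoring y (i′ , δ i′))     ≡⟨ entry i′ ⟨
    lookup (shift (suc k) y u) i′         ∎))
  where
  open ≡-Reasoning
  u = tabulate (toℕ ∘ δ)
  entry : ∀ i → lookup (shift (suc k) y u) i ≡ toℕ (shiftColoring y (i , δ i))
  entry i = begin
    lookup (shift (suc k) y u) i          ≡⟨ lookup-zipWith _ i y u ⟩
    (lookup y i + lookup u i) % suc k     ≡⟨ cong (λ x → (lookup y i + x) % suc k) (lookup∘tabulate (toℕ ∘ δ) i) ⟩
    (lookup y i + toℕ (δ i)) % suc k      ≡⟨ toℕ-shiftColoring y i (δ i) ⟨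
    toℕ (shiftColoring y (i , δ i))       ∎
shiftColoring-proper δ y ok _ _ (starˡ i j j≢δi) eq = j≢δi (sym (shiftColoring-injectiveʳ y i eq))
shiftColoring-proper δ y ok _ _ (starʳ i j j≢δi) eq = j≢δi (shiftColoring-injectiveʳ y i eq)

module ShiftColoringFamily (k : ℕ) where

  hit : Vec ℕ k → Vec ℕ k → Bool
  hit u y = fresh [] (shift (suc k) y u)

  open GreedyCover hit (vectors (suc k) k) (replicate k 0) (suc k !) (λ u → fresh-shifts (suc k) k [] u ≤-refl)

  shiftColoringFamily : ∀ t → k ^ k * (suc k ^ k ∸ suc k !) ^ t < (suc k ^ k) ^ t →
                        Σ[ F ∈ List (Coloring k) ] IsColoringFamily k F × length F ≡ t
  shiftColoringFamily t few-left =
    let Z , |Z|≡t , covers = greedyCover t (vectors k k) few-left′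
    in map shiftColoring Z , isColoringFamily Z covers , trans (length-map shiftColoring Z) |Z|≡t
    where
    few-left′ : length (vectors k k) * (N ∸ suc k !) ^ t < N ^ t
    few-left′ rewrite length-vectors k k | length-vectors (suc k) k = few-left
    isColoringFamily : ∀ Z → (∀ {u} → u ∈ vectors k k → Any (T ∘ hit u) Z) → IsColoringFamily k (map shiftColoring Z)
    isColoringFamily Z covers δ = map⁺ (Any.map (λ {y} → shiftColoring-proper δ y) (covers (∈-vectors (tabulate⁺ (toℕ<n ∘ δ)))))

4^[2+k]*[1+k]^2≤2^[6*[1+k]] : ∀ k → 4 ^ suc (suc k) * (suc k * suc k) ≤ 2 ^ (6 * suc k)
4^[2+k]*[1+k]^2≤2^[6*[1+k]] k = begin
  4 ^ m * (K * K)               ≤⟨ *-monoʳ-≤ (4 ^ m) (*-mono-≤ (<⇒≤ (n<2^n K)) (<⇒≤ (n<2^n K))) ⟩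
  4 ^ m * (2 ^ K * 2 ^ K)       ≡⟨ cong₂ _*_ (^-*-assoc 2 2 m) (sym (^-distribˡ-+-* 2 K K)) ⟩
  2 ^ (2 * m) * 2 ^ (K + K)     ≡⟨ ^-distribˡ-+-* 2 (2 * m) (K + K) ⟨
  2 ^ (2 * m + (K + K))         ≤⟨ ^-monoʳ-≤ 2 (≤-trans (m≤m+n (2 * m + (K + K)) (2 * k)) (≤-reflexive (exponents k))) ⟩
  2 ^ (6 * K)                   ∎
  where
  open ≤-Reasoning
  K = suc k
  m = suc K
  exponents : ∀ k → 2 * suc (suc k) + (suc k + suc k) + 2 * k ≡ 6 * suc k
  exponents = solve-∀

coloringFamily : ∀ k → Σ[ F ∈ List (Coloring (suc k)) ] IsColoringFamily (suc k) F × length F ≤ 2 ^ (6 * suc k)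
coloringFamily k =
  let F , isColoringFamily , |F|≡rounds = ShiftColoringFamily.shiftColoringFamily K rounds few-left
  in F , isColoringFamily , ≤-trans (≤-reflexive |F|≡rounds) (4^[2+k]*[1+k]^2≤2^[6*[1+k]] k)
  where
  K = suc k
  m = suc K
  rounds = 4 ^ m * (K * K)
  few-left : K ^ K * (m ^ K ∸ m !) ^ rounds < (m ^ K) ^ rounds
  few-left = s*[n∸g]^[l*e]<n^[l*e] (K ^ K) (m ^ K) (m !) (4 ^ m) (K * K) {{m^n≢0 m K}}
    (subst (K ^ K <_) (^-*-assoc 2 K K) (^-monoˡ-< K (n<2^n K)))
    ([1+n]!≤[1+n]^n K)
    (≤-trans (^-monoʳ-≤ m (n≤1+n K)) (n^n≤4^n*n! m))

lemma9 : Σ ℕ λ C → (k : ℕ) →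
    Σ (List (Coloring k)) λ F → IsColoringFamily k F × length F ≤ 2 ^ (C * k)
lemma9 = 6 , λ where
  zero    → (λ _ → zero) ∷ [] , (λ δ → here λ { (() , _) }) , ≤-refl
  (suc k) → coloringFamily k
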